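{- Let $n$ be an odd positive integer. Then $$\frac{(\frac{3}{2}-\frac{n}{4})_{\frac{n-1}{2}}}{(2-\frac{n}{2})_{\frac{n-1}{2}}}\,2^{\frac{n-1}{2}}=(-1)^{\frac{n^2-1}{8}+\frac{n-1}{2}}n.$$
   Context: For $a\in\mathbb{C}$ and $k\in\mathbb{N}$, $(a)_k=a(a+1)\cdots(a+k-1)$ denotes the rising factorial, with $(a)_0=1$. -}

module Defs where

open import Data.Nat using (ℕ; zero; suc)
open import Data.Integer using (+_)
open import Data.Rational using (ℚ; 1ℚ; _+_; _*_; _/_)

rising : ℚ → ℕ → ℚ
rising a zero    = 1ℚ
rising a (suc k) = rising a k * (a + (+ k / 1))

pow : ℚ → ℕ → ℚ
pow q zero    = 1ℚ
pow q (suc k) = pow q k * q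

{-# OPTIONS --safe #-}
module Submission where

-- Write n = 2k + 1, α = 3/2 - n/4 and β = 2 - n/2.  Replacing n by n + 4 lowers α by 1 and β by 2,
-- so (α)_k acquires the factors (α - 1)(α + k) and (β)_k the factors (β - 2)(β - 1); since
-- α - 1 = (2 - n)/4, α + k = (n + 4)/4, β - 2 = -n/2 and β - 1 = (2 - n)/2, the left-hand side,
-- whose power of 2 gains a factor 4, is multiplied by -(n + 4)/n.  So is the right-hand side: (n² - 1)/8 + k grows by 2k + 5.
-- Induction from n = 1 and n = 3 gives the identity with the denominator cleared; the
-- denominator never vanishes because 2(β + j) = 3 + 2j - 2k is odd.

open import Defs
open import Data.Nat using (ℕ; zero; suc; _∸_; _%_)
import Data.Nat as ℕ
import Data.Nat.Properties as ℕ
import Data.Nat.Tactic.RingSolver as ℕ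
open import Data.Nat.DivMod using (_/_; +-distrib-/-∣ʳ; m*n/n≡m; m≡m%n+[m/n]*n)
open import Data.Nat.Divisibility using (divides)
open import Data.Integer as ℤ using (+_)
import Data.Integer.Properties as ℤ
open import Data.Rational using (ℚ; NonZero; _÷_; _+_; _*_; _-_; -_; 0ℚ; 1ℚ; 1/_; toℚᵘ; ≢-nonZero)
  renaming (_/_ to _/ℚ_)
open import Data.Rational.Properties
  using ( toℚᵘ-injective; toℚᵘ-fromℚᵘ; toℚᵘ-homo-+; toℚᵘ-homo-*; toℚᵘ-cong; +-*-commutativeRing; _≟_
        ; +-identityˡ; +-identityʳ; +-assoc; *-identityˡ; *-identityʳ; *-assoc; *-zeroˡ; *-distribʳ-+; *-inverseʳ)
import Data.Rational.Unnormalised as ℚᵘ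
import Data.Rational.Unnormalised.Properties as ℚᵘ
open import Data.Product using (Σ; _,_)
open import Level using (0ℓ)
open import Relation.Binary.PropositionalEquality using (_≡_; _≢_; refl; sym; trans; cong; cong₂; module ≡-Reasoning)
open import Relation.Nullary.Decidable using (dec⇒maybe)
open import Tactic.RingSolver using (solve-∀)
open import Tactic.RingSolver.Core.AlmostCommutativeRing using (AlmostCommutativeRing; fromCommutativeRing)

ℚ-ring : AlmostCommutativeRing 0ℓ 0ℓ
ℚ-ring = fromCommutativeRing +-*-commutativeRing λ p → dec⇒maybe (0ℚ ≟ p)

fromℕ : ℕ → ℚ
fromℕ m = + m /ℚ 1

toℚᵘ-fromℕ : ∀ m → toℚᵘ (fromℕ m) ℚᵘ.≃ ℚᵘ.mkℚᵘ (+ m) 0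
toℚᵘ-fromℕ m = toℚᵘ-fromℚᵘ (ℚᵘ.mkℚᵘ (+ m) 0)

fromℕ-suc : ∀ m → fromℕ (suc m) ≡ 1ℚ + fromℕ m
fromℕ-suc m = toℚᵘ-injective (begin
  toℚᵘ (fromℕ (suc m))           ≈⟨ toℚᵘ-fromℕ (suc m) ⟩
  ℚᵘ.mkℚᵘ (+ suc m) 0            ≈⟨ ℚᵘ.*≡* (cong (ℤ._* + 1) (cong (ℤ._+_ (+ 1)) (sym (ℤ.*-identityʳ (+ m))))) ⟩
  ℚᵘ.1ℚᵘ ℚᵘ.+ ℚᵘ.mkℚᵘ (+ m) 0    ≈⟨ ℚᵘ.+-congʳ ℚᵘ.1ℚᵘ (toℚᵘ-fromℕ m) ⟨
  toℚᵘ 1ℚ ℚᵘ.+ toℚᵘ (fromℕ m)    ≈⟨ toℚᵘ-homo-+ 1ℚ (fromℕ m) ⟨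
  toℚᵘ (1ℚ + fromℕ m)            ∎)
  where open ℚᵘ.≃-Reasoning

fromℕ-homo-+ : ∀ m n → fromℕ (m ℕ.+ n) ≡ fromℕ m + fromℕ n
fromℕ-homo-+ zero    n = sym (+-identityˡ (fromℕ n))
fromℕ-homo-+ (suc m) n = begin
  fromℕ (suc (m ℕ.+ n))         ≡⟨ fromℕ-suc (m ℕ.+ n) ⟩
  1ℚ + fromℕ (m ℕ.+ n)          ≡⟨ cong (_+_ 1ℚ) (fromℕ-homo-+ m n) ⟩
  1ℚ + (fromℕ m + fromℕ n)      ≡⟨ +-assoc 1ℚ (fromℕ m) (fromℕ n) ⟨
  (1ℚ + fromℕ m) + fromℕ n      ≡⟨ cong (_+ fromℕ n) (fromℕ-suc m) ⟨
  fromℕ (suc m) + fromℕ n       ∎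
  where open ≡-Reasoning

fromℕ-homo-* : ∀ m n → fromℕ (m ℕ.* n) ≡ fromℕ m * fromℕ n
fromℕ-homo-* zero    n = sym (*-zeroˡ (fromℕ n))
fromℕ-homo-* (suc m) n = begin
  fromℕ (n ℕ.+ m ℕ.* n)            ≡⟨ fromℕ-homo-+ n (m ℕ.* n) ⟩
  fromℕ n + fromℕ (m ℕ.* n)        ≡⟨ cong (_+_ (fromℕ n)) (fromℕ-homo-* m n) ⟩
  fromℕ n + fromℕ m * fromℕ n      ≡⟨ cong (_+ fromℕ m * fromℕ n) (*-identityˡ (fromℕ n)) ⟨
  1ℚ * fromℕ n + fromℕ m * fromℕ n ≡⟨ *-distribʳ-+ (fromℕ n) 1ℚ (fromℕ m) ⟨
  (1ℚ + fromℕ m) * fromℕ n         ≡⟨ cong (_* fromℕ n) (fromℕ-suc m) ⟨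
  fromℕ (suc m) * fromℕ n          ∎
  where open ≡-Reasoning

fromℕ-injective : ∀ {m n} → fromℕ m ≡ fromℕ n → m ≡ n
fromℕ-injective {m} {n} eq
  with ℚᵘ.*≡* eq′ ← ℚᵘ.≃-trans (ℚᵘ.≃-sym (toℚᵘ-fromℕ m)) (ℚᵘ.≃-trans (toℚᵘ-cong eq) (toℚᵘ-fromℕ n))
  = ℤ.+-injective (trans (sym (ℤ.*-identityʳ (+ m))) (trans eq′ (ℤ.*-identityʳ (+ n))))

+m/d≡m*[1/d] : ∀ m d .{{_ : ℕ.NonZero d}} → + m /ℚ d ≡ fromℕ m * (+ 1 /ℚ d)
+m/d≡m*[1/d] m (suc d) = toℚᵘ-injective (begin
  toℚᵘ (+ m /ℚ suc d)                         ≈⟨ toℚᵘ-fromℚᵘ (ℚᵘ.mkℚᵘ (+ m) d) ⟩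
  ℚᵘ.mkℚᵘ (+ m) d                             ≈⟨ ℚᵘ.*≡* (cong₂ ℤ._*_ (sym (ℤ.*-identityʳ (+ m))) (cong +_ (ℕ.*-identityˡ (suc d)))) ⟩
  ℚᵘ.mkℚᵘ (+ m) 0 ℚᵘ.* ℚᵘ.mkℚᵘ (+ 1) d        ≈⟨ ℚᵘ.*-cong (toℚᵘ-fromℕ m) (toℚᵘ-fromℚᵘ (ℚᵘ.mkℚᵘ (+ 1) d)) ⟨
  toℚᵘ (fromℕ m) ℚᵘ.* toℚᵘ (+ 1 /ℚ suc d)      ≈⟨ toℚᵘ-homo-* (fromℕ m) (+ 1 /ℚ suc d) ⟨
  toℚᵘ (fromℕ m * (+ 1 /ℚ suc d))             ∎)
  where open ℚᵘ.≃-Reasoning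

p*q≢0 : ∀ {p q} → p ≢ 0ℚ → q ≢ 0ℚ → p * q ≢ 0ℚ
p*q≢0 {p} {q} p≢0 q≢0 pq≡0 = p≢0 (begin
  p                ≡⟨ *-identityʳ p ⟨
  p * 1ℚ           ≡⟨ cong (_*_ p) (*-inverseʳ q) ⟨
  p * (q * (1/ q)) ≡⟨ *-assoc p q (1/ q) ⟨
  (p * q) * (1/ q) ≡⟨ cong (_* (1/ q)) pq≡0 ⟩
  0ℚ * (1/ q)      ≡⟨ *-zeroˡ (1/ q) ⟩
  0ℚ               ∎)
  where open ≡-Reasoning
        instance _ = ≢-nonZero q≢0

p*r≡s*q⇒[p÷q]*r≡s : ∀ p q r s .{{_ : NonZero q}} → p * r ≡ s * q → (p ÷ q) * r ≡ s
p*r≡s*q⇒[p÷q]*r≡s p q r s pr≡sq = begin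
  p * (1/ q) * r   ≡⟨ swap p (1/ q) r ⟩
  p * r * (1/ q)   ≡⟨ cong (_* (1/ q)) pr≡sq ⟩
  s * q * (1/ q)   ≡⟨ *-assoc s q (1/ q) ⟩
  s * (q * (1/ q)) ≡⟨ cong (_*_ s) (*-inverseʳ q) ⟩
  s * 1ℚ           ≡⟨ *-identityʳ s ⟩
  s                ∎
  where open ≡-Reasoning
        swap : ∀ a b c → a * b * c ≡ a * c * b
        swap = solve-∀ ℚ-ring

pow-distribˡ-+-* : ∀ p m n → pow p (m ℕ.+ n) ≡ pow p m * pow p n
pow-distribˡ-+-* p zero    n = sym (*-identityˡ (pow p n))
pow-distribˡ-+-* p (suc m) n = begin
  pow p (m ℕ.+ n) * p       ≡⟨ cong (_* p) (pow-distribˡ-+-* p m n) ⟩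
  pow p m * pow p n * p     ≡⟨ swap (pow p m) (pow p n) p ⟩
  pow p m * p * pow p n     ∎
  where open ≡-Reasoning
        swap : ∀ a b c → a * b * c ≡ a * c * b
        swap = solve-∀ ℚ-ring

pow-neg1-even : ∀ m → pow (- 1ℚ) (2 ℕ.* m) ≡ 1ℚ
pow-neg1-even zero    = refl
pow-neg1-even (suc m) = begin
  pow (- 1ℚ) (2 ℕ.* suc m)           ≡⟨ cong (pow (- 1ℚ)) (ℕ.*-suc 2 m) ⟩
  pow (- 1ℚ) (2 ℕ.* m) * - 1ℚ * - 1ℚ ≡⟨ cong (λ t → t * - 1ℚ * - 1ℚ) (pow-neg1-even m) ⟩
  1ℚ * - 1ℚ * - 1ℚ                   ≡⟨⟩
  1ℚ                                 ∎
  where open ≡-Reasoning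

pow-neg1-odd-+ : ∀ m e → pow (- 1ℚ) (suc (2 ℕ.* m) ℕ.+ e) ≡ - pow (- 1ℚ) e
pow-neg1-odd-+ m e = begin
  pow (- 1ℚ) (2 ℕ.* m ℕ.+ e) * - 1ℚ           ≡⟨ cong (_* - 1ℚ) (pow-distribˡ-+-* (- 1ℚ) (2 ℕ.* m) e) ⟩
  pow (- 1ℚ) (2 ℕ.* m) * pow (- 1ℚ) e * - 1ℚ  ≡⟨ cong (λ t → t * pow (- 1ℚ) e * - 1ℚ) (pow-neg1-even m) ⟩
  1ℚ * pow (- 1ℚ) e * - 1ℚ                    ≡⟨ negate (pow (- 1ℚ) e) ⟩
  - pow (- 1ℚ) e                              ∎
  where open ≡-Reasoning
        negate : ∀ a → 1ℚ * a * - 1ℚ ≡ - a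
        negate = solve-∀ ℚ-ring

rising-pred : ∀ a k → rising (a - 1ℚ) (suc k) ≡ (a - 1ℚ) * rising a k
rising-pred a zero    = single-factor (a - 1ℚ)
  where single-factor : ∀ b → 1ℚ * (b + 0ℚ) ≡ b * 1ℚ
        single-factor = solve-∀ ℚ-ring
rising-pred a (suc k) = begin
  rising (a - 1ℚ) (suc k) * ((a - 1ℚ) + fromℕ (suc k))    ≡⟨ cong₂ _*_ (rising-pred a k) (cong (_+_ (a - 1ℚ)) (fromℕ-suc k)) ⟩
  (a - 1ℚ) * rising a k * ((a - 1ℚ) + (1ℚ + fromℕ k))     ≡⟨ regroup a (rising a k) (fromℕ k) ⟩
  (a - 1ℚ) * (rising a k * (a + fromℕ k))                 ∎
  where open ≡-Reasoning
        regroup : ∀ b r x → (b - 1ℚ) * r * ((b - 1ℚ) + (1ℚ + x)) ≡ (b - 1ℚ) * (r * (b + x))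
        regroup = solve-∀ ℚ-ring

rising-≢0 : ∀ a → (∀ j → a + fromℕ j ≢ 0ℚ) → ∀ k → rising a k ≢ 0ℚ
rising-≢0 a a+j≢0 zero    ()
rising-≢0 a a+j≢0 (suc k) = p*q≢0 (rising-≢0 a a+j≢0 k) (a+j≢0 k)

[m+n*d]/d≡m/d+n : ∀ m n d .{{_ : ℕ.NonZero d}} → (m ℕ.+ n ℕ.* d) / d ≡ m / d ℕ.+ n
[m+n*d]/d≡m/d+n m n d = trans (+-distrib-/-∣ʳ m (divides n refl)) (cong (m / d ℕ.+_) (m*n/n≡m n d))

[2*k]/2≡k : ∀ k → 2 ℕ.* k / 2 ≡ k
[2*k]/2≡k k = trans (cong (_/ 2) (ℕ.*-comm 2 k)) (m*n/n≡m k 2)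

oddℕ : ℕ → ℕ
oddℕ k = suc (2 ℕ.* k)

oddℕ[n/2]≡n : ∀ n → n % 2 ≡ 1 → oddℕ (n / 2) ≡ n
oddℕ[n/2]≡n n n%2≡1 = sym (begin
  n                     ≡⟨ m≡m%n+[m/n]*n n 2 ⟩
  n % 2 ℕ.+ n / 2 ℕ.* 2 ≡⟨ cong₂ ℕ._+_ n%2≡1 (ℕ.*-comm (n / 2) 2) ⟩
  oddℕ (n / 2)          ∎)
  where open ≡-Reasoning

α β sign : ℕ → ℚ
α k    = (+ 3 /ℚ 2) - (+ oddℕ k /ℚ 4)
β k    = (+ 2 /ℚ 1) - (+ oddℕ k /ℚ 2)
sign k = pow (- 1ℚ) ((oddℕ k ℕ.* oddℕ k ∸ 1) / 8 ℕ.+ k)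

fromℕ-oddℕ : ∀ k → fromℕ (oddℕ k) ≡ 1ℚ + fromℕ 2 * fromℕ k
fromℕ-oddℕ k = trans (fromℕ-homo-+ 1 (2 ℕ.* k)) (cong (_+_ 1ℚ) (fromℕ-homo-* 2 k))

α-poly : ∀ k → α k ≡ (+ 3 /ℚ 2) - (1ℚ + fromℕ 2 * fromℕ k) * (+ 1 /ℚ 4)
α-poly k = cong (_-_ (+ 3 /ℚ 2)) (trans (+m/d≡m*[1/d] (oddℕ k) 4) (cong (_* (+ 1 /ℚ 4)) (fromℕ-oddℕ k)))

β-poly : ∀ k → β k ≡ fromℕ 2 - (1ℚ + fromℕ 2 * fromℕ k) * (+ 1 /ℚ 2)
β-poly k = cong (_-_ (fromℕ 2)) (trans (+m/d≡m*[1/d] (oddℕ k) 2) (cong (_* (+ 1 /ℚ 2)) (fromℕ-oddℕ k)))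
α-step : ∀ k → α (2 ℕ.+ k) ≡ α k - 1ℚ
α-step k = begin
  α (2 ℕ.+ k)                                       ≡⟨ α-poly (2 ℕ.+ k) ⟩
  c - (1ℚ + fromℕ 2 * fromℕ (2 ℕ.+ k)) * ¼          ≡⟨ cong (λ t → c - (1ℚ + fromℕ 2 * t) * ¼) (fromℕ-homo-+ 2 k) ⟩
  c - (1ℚ + fromℕ 2 * (fromℕ 2 + fromℕ k)) * ¼      ≡⟨ shift (fromℕ k) ⟩
  (c - (1ℚ + fromℕ 2 * fromℕ k) * ¼) - 1ℚ           ≡⟨ cong (_- 1ℚ) (α-poly k) ⟨
  α k - 1ℚ                                          ∎
  where open ≡-Reasoning
        c ¼ : ℚ
        c = + 3 /ℚ 2
        ¼ = + 1 /ℚ 4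
        shift : ∀ x → (+ 3 /ℚ 2) - (1ℚ + fromℕ 2 * (fromℕ 2 + x)) * (+ 1 /ℚ 4)
                    ≡ ((+ 3 /ℚ 2) - (1ℚ + fromℕ 2 * x) * (+ 1 /ℚ 4)) - 1ℚ
        shift = solve-∀ ℚ-ring

β-step : ∀ k → β (2 ℕ.+ k) ≡ (β k - 1ℚ) - 1ℚ
β-step k = begin
  β (2 ℕ.+ k)                                       ≡⟨ β-poly (2 ℕ.+ k) ⟩
  c - (1ℚ + fromℕ 2 * fromℕ (2 ℕ.+ k)) * ½          ≡⟨ cong (λ t → c - (1ℚ + fromℕ 2 * t) * ½) (fromℕ-homo-+ 2 k) ⟩
  c - (1ℚ + fromℕ 2 * (fromℕ 2 + fromℕ k)) * ½      ≡⟨ shift (fromℕ k) ⟩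
  ((c - (1ℚ + fromℕ 2 * fromℕ k) * ½) - 1ℚ) - 1ℚ    ≡⟨ cong (λ b → (b - 1ℚ) - 1ℚ) (β-poly k) ⟨
  (β k - 1ℚ) - 1ℚ                                   ∎
  where open ≡-Reasoning
        c ½ : ℚ
        c = fromℕ 2
        ½ = + 1 /ℚ 2
        shift : ∀ x → fromℕ 2 - (1ℚ + fromℕ 2 * (fromℕ 2 + x)) * (+ 1 /ℚ 2)
                    ≡ ((fromℕ 2 - (1ℚ + fromℕ 2 * x) * (+ 1 /ℚ 2)) - 1ℚ) - 1ℚ
        shift = solve-∀ ℚ-ring

step-identity : ∀ k → (α k - 1ℚ) * (α k + fromℕ k) * fromℕ 4 * fromℕ (oddℕ k)
                    ≡ - fromℕ (oddℕ (2 ℕ.+ k)) * (((β k - 1ℚ) - 1ℚ) * (β k - 1ℚ))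
step-identity k = instantiate (α-poly k) (β-poly k) (fromℕ-oddℕ k) (fromℕ-oddℕ (2 ℕ.+ k)) (fromℕ-homo-+ 2 k)
  where
  -- Matching on refl substitutes the polynomial forms in x, leaving a ring identity for the solver.
  instantiate : ∀ {a b y y′ x′ x} →
    a ≡ (+ 3 /ℚ 2) - (1ℚ + fromℕ 2 * x) * (+ 1 /ℚ 4) → b ≡ fromℕ 2 - (1ℚ + fromℕ 2 * x) * (+ 1 /ℚ 2) →
    y ≡ 1ℚ + fromℕ 2 * x → y′ ≡ 1ℚ + fromℕ 2 * x′ → x′ ≡ fromℕ 2 + x →
    (a - 1ℚ) * (a + x) * fromℕ 4 * y ≡ - y′ * (((b - 1ℚ) - 1ℚ) * (b - 1ℚ))
  instantiate {x = x} refl refl refl refl refl = polynomial-identity x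
    where
    polynomial-identity : ∀ x →
      ((+ 3 /ℚ 2) - (1ℚ + fromℕ 2 * x) * (+ 1 /ℚ 4) - 1ℚ) * ((+ 3 /ℚ 2) - (1ℚ + fromℕ 2 * x) * (+ 1 /ℚ 4) + x)
        * fromℕ 4 * (1ℚ + fromℕ 2 * x)
      ≡ - (1ℚ + fromℕ 2 * (fromℕ 2 + x))
        * (((fromℕ 2 - (1ℚ + fromℕ 2 * x) * (+ 1 /ℚ 2) - 1ℚ) - 1ℚ) * (fromℕ 2 - (1ℚ + fromℕ 2 * x) * (+ 1 /ℚ 2) - 1ℚ))
    polynomial-identity = solve-∀ ℚ-ring

sign-step : ∀ k → sign (2 ℕ.+ k) ≡ - sign k
sign-step k = trans (cong (pow (- 1ℚ)) exponent-step) (pow-neg1-odd-+ (2 ℕ.+ k) e)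
  where
  open ≡-Reasoning
  q = oddℕ k ℕ.* oddℕ k ∸ 1
  e = q / 8 ℕ.+ k
  -- (2m + 1)² ∸ 1 reduces to 2m + 2m(2m + 1), which is the form given to the solver.
  square-step : ∀ m → 2 ℕ.* (2 ℕ.+ m) ℕ.+ 2 ℕ.* (2 ℕ.+ m) ℕ.* suc (2 ℕ.* (2 ℕ.+ m))
                    ≡ (2 ℕ.* m ℕ.+ 2 ℕ.* m ℕ.* suc (2 ℕ.* m)) ℕ.+ (3 ℕ.+ 2 ℕ.* m) ℕ.* 8
  square-step = ℕ.solve-∀
  regroup : ∀ m r → r ℕ.+ (3 ℕ.+ 2 ℕ.* m) ℕ.+ (2 ℕ.+ m) ≡ suc (2 ℕ.* (2 ℕ.+ m)) ℕ.+ (r ℕ.+ m)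
  regroup = ℕ.solve-∀
  exponent-step : (oddℕ (2 ℕ.+ k) ℕ.* oddℕ (2 ℕ.+ k) ∸ 1) / 8 ℕ.+ (2 ℕ.+ k) ≡ oddℕ (2 ℕ.+ k) ℕ.+ e
  exponent-step = begin
    (oddℕ (2 ℕ.+ k) ℕ.* oddℕ (2 ℕ.+ k) ∸ 1) / 8 ℕ.+ (2 ℕ.+ k) ≡⟨ cong (λ u → u / 8 ℕ.+ (2 ℕ.+ k)) (square-step k) ⟩
    (q ℕ.+ (3 ℕ.+ 2 ℕ.* k) ℕ.* 8) / 8 ℕ.+ (2 ℕ.+ k)            ≡⟨ cong (ℕ._+ (2 ℕ.+ k)) ([m+n*d]/d≡m/d+n q (3 ℕ.+ 2 ℕ.* k) 8) ⟩
    q / 8 ℕ.+ (3 ℕ.+ 2 ℕ.* k) ℕ.+ (2 ℕ.+ k)                    ≡⟨ regroup k (q / 8) ⟩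
    oddℕ (2 ℕ.+ k) ℕ.+ e                                      ∎

β+j≢0 : ∀ k j → β k + fromℕ j ≢ 0ℚ
β+j≢0 k j β+j≡0 = ℕ.even≢odd (2 ℕ.+ j) k (fromℕ-injective (begin
  fromℕ (2 ℕ.* (2 ℕ.+ j))                        ≡⟨ doubled {z = fromℕ j} {x = fromℕ k} (β-poly k) (fromℕ-oddℕ k) (fromℕ-homo-* 2 (2 ℕ.+ j)) (fromℕ-homo-+ 2 j) ⟩
  fromℕ (oddℕ k) + (β k + fromℕ j) * fromℕ 2     ≡⟨ cong (λ b → fromℕ (oddℕ k) + b * fromℕ 2) β+j≡0 ⟩
  fromℕ (oddℕ k) + 0ℚ                            ≡⟨ +-identityʳ (fromℕ (oddℕ k)) ⟩
  fromℕ (oddℕ k)                                 ∎))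
  where
  open ≡-Reasoning
  doubled : ∀ {b y w z′ z x} →
    b ≡ fromℕ 2 - (1ℚ + fromℕ 2 * x) * (+ 1 /ℚ 2) → y ≡ 1ℚ + fromℕ 2 * x → w ≡ fromℕ 2 * z′ → z′ ≡ fromℕ 2 + z →
    w ≡ y + (b + z) * fromℕ 2
  doubled {z = z} {x = x} refl refl refl refl = polynomial-identity x z
    where
    polynomial-identity : ∀ x z → fromℕ 2 * (fromℕ 2 + z)
                                ≡ (1ℚ + fromℕ 2 * x) + ((fromℕ 2 - (1ℚ + fromℕ 2 * x) * (+ 1 /ℚ 2)) + z) * fromℕ 2
    polynomial-identity = solve-∀ ℚ-ring

denominator-step : ∀ k → rising (β (2 ℕ.+ k)) (2 ℕ.+ k) ≡ ((β k - 1ℚ) - 1ℚ) * ((β k - 1ℚ) * rising (β k) k)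
denominator-step k = begin
  rising (β (2 ℕ.+ k)) (2 ℕ.+ k)                        ≡⟨ cong (λ b → rising b (2 ℕ.+ k)) (β-step k) ⟩
  rising ((β k - 1ℚ) - 1ℚ) (2 ℕ.+ k)                    ≡⟨ rising-pred (β k - 1ℚ) (suc k) ⟩
  ((β k - 1ℚ) - 1ℚ) * rising (β k - 1ℚ) (suc k)         ≡⟨ cong (_*_ ((β k - 1ℚ) - 1ℚ)) (rising-pred (β k) k) ⟩
  ((β k - 1ℚ) - 1ℚ) * ((β k - 1ℚ) * rising (β k) k)     ∎
  where open ≡-Reasoning

cross-multiplied : ∀ k → rising (α k) k * pow (fromℕ 2) k ≡ sign k * fromℕ (oddℕ k) * rising (β k) k
cross-multiplied zero          = refl
cross-multiplied (suc zero)    = refl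
cross-multiplied (suc (suc k)) = begin
  rising (α (2 ℕ.+ k)) (2 ℕ.+ k) * (P * fromℕ 2 * fromℕ 2)  ≡⟨ cong (λ a′ → rising a′ (2 ℕ.+ k) * (P * fromℕ 2 * fromℕ 2)) (α-step k) ⟩
  rising (a - 1ℚ) (2 ℕ.+ k) * (P * fromℕ 2 * fromℕ 2)      ≡⟨ cong (_* (P * fromℕ 2 * fromℕ 2)) (rising-pred a (suc k)) ⟩
  (a - 1ℚ) * (N * (a + x)) * (P * fromℕ 2 * fromℕ 2)      ≡⟨ regroup₁ a N x P ⟩
  N * P * ((a - 1ℚ) * (a + x) * fromℕ 4)                  ≡⟨ cong (_* ((a - 1ℚ) * (a + x) * fromℕ 4)) (cross-multiplied k) ⟩
  S * y * D * ((a - 1ℚ) * (a + x) * fromℕ 4)              ≡⟨ regroup₂ S y D ((a - 1ℚ) * (a + x) * fromℕ 4) ⟩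
  S * ((a - 1ℚ) * (a + x) * fromℕ 4 * y) * D              ≡⟨ cong (λ t → S * t * D) (step-identity k) ⟩
  S * (- y′ * (((b - 1ℚ) - 1ℚ) * (b - 1ℚ))) * D          ≡⟨ regroup₃ S y′ ((b - 1ℚ) - 1ℚ) (b - 1ℚ) D ⟩
  - S * y′ * (((b - 1ℚ) - 1ℚ) * ((b - 1ℚ) * D))          ≡⟨ cong₂ (λ s r → s * y′ * r) (sign-step k) (denominator-step k) ⟨
  sign (2 ℕ.+ k) * y′ * rising (β (2 ℕ.+ k)) (2 ℕ.+ k)    ∎
  where
  open ≡-Reasoning
  a = α k
  b = β k
  x = fromℕ k
  y = fromℕ (oddℕ k)
  y′ = fromℕ (oddℕ (2 ℕ.+ k))
  N = rising a k
  D = rising b k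
  P = pow (fromℕ 2) k
  S = sign k
  regroup₁ : ∀ a N x P → (a - 1ℚ) * (N * (a + x)) * (P * fromℕ 2 * fromℕ 2) ≡ N * P * ((a - 1ℚ) * (a + x) * fromℕ 4)
  regroup₁ = solve-∀ ℚ-ring
  regroup₂ : ∀ S y D t → S * y * D * t ≡ S * (t * y) * D
  regroup₂ = solve-∀ ℚ-ring
  regroup₃ : ∀ S y′ u v D → S * (- y′ * (u * v)) * D ≡ - S * y′ * (u * (v * D))
  regroup₃ = solve-∀ ℚ-ring

identity-for-oddℕ : ∀ k → Σ (NonZero (rising (β k) k)) λ nz →
  _÷_ (rising (α k) k) (rising (β k) k) {{nz}} * pow (fromℕ 2) k ≡ sign k * fromℕ (oddℕ k)
identity-for-oddℕ k = nz , p*r≡s*q⇒[p÷q]*r≡s (rising (α k) k) (rising (β k) k) (pow (fromℕ 2) k) (sign k * fromℕ (oddℕ k)) (cross-multiplied k)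
  where instance nz = ≢-nonZero (rising-≢0 (β k) (β+j≢0 k) k)

mainTheorem7 : (n : ℕ) → n % 2 ≡ 1 →
    Σ (NonZero (rising ((+ 2 /ℚ 1) - (+ n /ℚ 2)) ((n ∸ 1) / 2))) λ nz →
      _÷_ (rising ((+ 3 /ℚ 2) - (+ n /ℚ 4)) ((n ∸ 1) / 2))
          (rising ((+ 2 /ℚ 1) - (+ n /ℚ 2)) ((n ∸ 1) / 2)) {{nz}}
        * pow (+ 2 /ℚ 1) ((n ∸ 1) / 2)
      ≡ pow (- 1ℚ) ((n Data.Nat.* n ∸ 1) / 8 Data.Nat.+ (n ∸ 1) / 2) * (+ n /ℚ 1)
mainTheorem7 n n%2≡1 with n / 2 | oddℕ[n/2]≡n n n%2≡1
... | k | refl rewrite [2*k]/2≡k k = identity-for-oddℕ k
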